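{- There is a constant $C>0$ such that for every integer $n\ge 2$, the complete bipartite graph $K_{n,n}$ has a separating $\mathcal B$-system of size at most $C\log n$.
   Context: $\mathcal B$ denotes the class of balanced complete bipartite graphs $K_{m,m}$, $m\ge 1$. A separating $\mathcal B$-system of a graph $G$ is a family $\mathcal F$ of subgraphs of $G$, each isomorphic to a member of $\mathcal B$, such that for every two distinct edges $e,e'\in E(G)$ there is $F\in\mathcal F$ containing $e$ but not $e'$ and there is $F'\in\mathcal F$ containing $e'$ but not $e$. -}

module Defs where

open import Data.Nat using (ℕ; _≤_)
open import Data.Fin using (Fin)
open import Data.Sum using (_⊎_; inj₁; inj₂)
open import Data.Product using (_×_; Σ; ∃; ∃-syntax; _,_)
open import Data.Unit using (⊤)
open import Data.Empty using (⊥)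
open import Data.List using (List)
open import Data.List.Membership.Propositional using (_∈_)
open import Relation.Nullary using (¬_)
open import Relation.Binary.PropositionalEquality using (_≡_; _≢_)
open import Function.Definitions using (Injective)

Vtx : ℕ → Set
Vtx n = Fin n ⊎ Fin n

Adj : ∀ {n} → Vtx n → Vtx n → Set
Adj (inj₁ _) (inj₁ _) = ⊥
Adj (inj₁ _) (inj₂ _) = ⊤
Adj (inj₂ _) (inj₁ _) = ⊤
Adj (inj₂ _) (inj₂ _) = ⊥

-- The edge {inj₁ a, inj₂ b} of K_{n,n} is represented by the pair (a , b);
-- this is a bijection between Fin n × Fin n and E(K_{n,n}).
Edge : ℕ → Set
Edge n = Fin n × Fin n

-- The subgraph H has vertex set im f ∪ im g and edge
-- set { f i g j : i j }.
record BSub (n : ℕ) : Set where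
  field
    m     : ℕ
    m≥1   : 1 ≤ m
    f     : Fin m → Vtx n
    g     : Fin m → Vtx n
    f-inj : Injective _≡_ _≡_ f
    g-inj : Injective _≡_ _≡_ g
    disj  : ∀ i j → f i ≢ g j
    adj   : ∀ i j → Adj (f i) (g j)

_∈E_ : ∀ {n} → Edge n → BSub n → Set
(a , b) ∈E H = ∃[ i ] ∃[ j ]
    ((f i ≡ inj₁ a × g j ≡ inj₂ b) ⊎ (f i ≡ inj₂ b × g j ≡ inj₁ a))
  where open BSub H

Separating : ∀ {n} → List (BSub n) → Set
Separating {n} F = ∀ (e e' : Edge n) → e ≢ e' →
  (∃[ H ] (H ∈ F × e ∈E H × ¬ (e' ∈E H))) ×
  (∃[ H ] (H ∈ F × e' ∈E H × ¬ (e ∈E H)))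

-- If 𝒮 is a family of h-subsets of
-- Fin n such that for x ≠ x' some member contains x but not x', and 𝒞 is a family of
-- h-subsets covering Fin n, then the balanced bicliques S × T and T × S (S ∈ 𝒮, T ∈ 𝒞)
-- separate edges: for ab ≠ a'b' with a ≠ a', take S ∋ a missing a' and T ∋ b.
-- For n = 2m view Fin n as Bool × Fin m; the m-sets {(χ i , i)} with χ constant, a binary
-- digit or a negated binary digit give |𝒮| = O(log n) and |𝒞| = 2. For n = 2m + 1 transport
-- these families along two embeddings Fin 2m ↪ Fin n that miss different points; a point
-- missed by an embedding lies outside every transported set, so covering sets separate it.
module Submission where

open import Defs
open import Data.Nat using (ℕ; _≤_; _*_)
open import Data.Nat.Logarithm using (⌊log₂_⌋)
open import Data.List using (List; length)
open import Data.Product using (_×_; ∃-syntax)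

open import Data.Bool using (Bool; true; false; not)
import Data.Bool.Properties as Bool
open import Data.Fin using (Fin; zero; suc; punchIn; inject≤)
open import Data.Fin.Properties
  using (_≟_; punchIn-injective; punchInᵢ≢i; punchIn-punchOut; inject≤-injective; 2↔Bool; *↔×)
open import Data.List using ([]; _∷_; _++_; map; cartesianProductWith)
open import Data.List.Membership.Propositional using (_∈_)
open import Data.List.Membership.Propositional.Properties
  using (∈-map⁺; ∈-++⁺ˡ; ∈-++⁺ʳ; ∈-cartesianProductWith⁺)
open import Data.List.Properties using (length-++; length-map)
open import Data.List.Relation.Binary.Subset.Propositional using (_⊆_)
open import Data.List.Relation.Unary.Any using (here; there)
open import Data.Nat using (suc; _+_; _^_; _<_; z≤n; s≤s)
open import Data.Nat.Logarithm using (⌊log₂⌋-mono-≤; ⌊log₂[2^n]⌋≡n)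
open import Data.Nat.Properties
  using (≤-refl; ≤-reflexive; ≤-trans; ≤-<-trans; <⇒≤; ≰⇒>; 1+n≰n; n≤1+n; m≤m+n;
         +-mono-≤; +-monoˡ-≤; *-mono-≤; *-monoʳ-≤; *-cancelˡ-<; *-suc; module ≤-Reasoning)
open import Data.Nat.Tactic.RingSolver using (solve-∀)
open import Data.Product using (_,_; proj₁; proj₂)
open import Data.Product.Function.NonDependent.Propositional using (_×-↔_)
open import Data.Sum using (inj₁; inj₂)
open import Data.Sum.Properties using (inj₁-injective; inj₂-injective)
open import Data.Unit using (tt)
open import Function using (_∘_; const; _↣_; _↔_; Injection; Inverse; Injective; mk↣)
open import Function.Construct.Composition using (_↣-∘_; _↔-∘_)
open import Function.Construct.Identity using (↔-id)
open import Function.Properties.Inverse using (↔⇒↣; ↔-sym)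
open import Relation.Binary.PropositionalEquality
  using (_≡_; _≢_; refl; sym; trans; cong; cong₂; subst; subst₂; module ≡-Reasoning)
open import Relation.Nullary using (¬_; yes; no; contradiction)

private variable
  A B C : Set
  h m n s c : ℕ

Part : ℕ → Set → Set
Part h A = Fin h ↣ A

-- A record rather than a Σ-type, so that S can be inferred from a membership proof.
record _∈ᵖ_ (x : A) (S : Part h A) : Set where
  constructor member
  field
    index    : Fin h
    to-index : Injection.to S index ≡ x

_∉ᵖ_ : A → Part h A → Set
x ∉ᵖ S = ¬ x ∈ᵖ S

Separated : List (Part h A) → A → A → Set
Separated 𝒮 x x' = ∃[ S ] (S ∈ 𝒮 × x ∈ᵖ S × x' ∉ᵖ S)

Separates : List (Part h A) → Set
Separates 𝒮 = ∀ {x x'} → x ≢ x' → Separated 𝒮 x x'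

Covered : List (Part h A) → A → Set
Covered 𝒞 x = ∃[ S ] (S ∈ 𝒞 × x ∈ᵖ S)

Covers : List (Part h A) → Set
Covers 𝒞 = ∀ x → Covered 𝒞 x

separated-⊆ : ∀ {𝒮 𝒯 : List (Part h A)} {x x'} → 𝒮 ⊆ 𝒯 → Separated 𝒮 x x' → Separated 𝒯 x x'
separated-⊆ 𝒮⊆𝒯 (S , S∈𝒮 , x∈S , x'∉S) = S , 𝒮⊆𝒯 S∈𝒮 , x∈S , x'∉S

covered-⊆ : ∀ {𝒞 𝒟 : List (Part h A)} {x} → 𝒞 ⊆ 𝒟 → Covered 𝒞 x → Covered 𝒟 x
covered-⊆ 𝒞⊆𝒟 (S , S∈𝒞 , x∈S) = S , 𝒞⊆𝒟 S∈𝒞 , x∈S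

record PartSystem (h : ℕ) (A : Set) (s c : ℕ) : Set where
  field
    separators        : List (Part h A)
    covering          : List (Part h A)
    separates         : Separates separators
    separators-cover  : Covers separators
    covers            : Covers covering
    length-separators : length separators ≡ s
    length-covering   : length covering ≡ c

_⊗_ : Part (suc h) (Fin n) → Part (suc h) (Fin n) → BSub n
_⊗_ {h} S T = record
  { m     = suc h
  ; m≥1   = s≤s z≤n
  ; f     = inj₁ ∘ to S
  ; g     = inj₂ ∘ to T
  ; f-inj = λ eq → injective S (inj₁-injective eq)
  ; g-inj = λ eq → injective T (inj₂-injective eq)
  ; disj  = λ _ _ ()
  ; adj   = λ _ _ → tt
  }
  where open Injection

∈E-⊗⁺ : ∀ {S T : Part (suc h) (Fin n)} {a b} → a ∈ᵖ S → b ∈ᵖ T → (a , b) ∈E (S ⊗ T)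
∈E-⊗⁺ (member i refl) (member j refl) = i , j , inj₁ (refl , refl)

∈E-⊗⁻ : ∀ (S T : Part (suc h) (Fin n)) {a b} → (a , b) ∈E (S ⊗ T) → a ∈ᵖ S × b ∈ᵖ T
∈E-⊗⁻ S T (i , j , inj₁ (refl , refl)) = member i refl , member j refl

length-cartesianProductWith : ∀ (f : A → B → C) xs ys →
  length (cartesianProductWith f xs ys) ≡ length xs * length ys
length-cartesianProductWith f []       ys = refl
length-cartesianProductWith f (x ∷ xs) ys = begin
  length (map (f x) ys ++ cartesianProductWith f xs ys)
    ≡⟨ length-++ (map (f x) ys) ⟩
  length (map (f x) ys) + length (cartesianProductWith f xs ys)
    ≡⟨ cong₂ _+_ (length-map (f x) ys) (length-cartesianProductWith f xs ys) ⟩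
  length ys + length xs * length ys ∎
  where open ≡-Reasoning

products : List (Part (suc h) (Fin n)) → List (Part (suc h) (Fin n)) → List (BSub n)
products 𝒮 𝒞 = cartesianProductWith _⊗_ 𝒮 𝒞 ++ cartesianProductWith _⊗_ 𝒞 𝒮

length-products : ∀ (𝒮 𝒞 : List (Part (suc h) (Fin n))) →
  length (products 𝒮 𝒞) ≡ length 𝒮 * length 𝒞 + length 𝒞 * length 𝒮
length-products 𝒮 𝒞 = trans (length-++ (cartesianProductWith _⊗_ 𝒮 𝒞))
  (cong₂ _+_ (length-cartesianProductWith _⊗_ 𝒮 𝒞) (length-cartesianProductWith _⊗_ 𝒞 𝒮))

∈-products⁺ˡ : ∀ {𝒮 𝒞 : List (Part (suc h) (Fin n))} {S T} → S ∈ 𝒮 → T ∈ 𝒞 → S ⊗ T ∈ products 𝒮 𝒞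
∈-products⁺ˡ {h} {n} S∈𝒮 T∈𝒞 = ∈-++⁺ˡ (∈-cartesianProductWith⁺ (_⊗_ {h} {n}) S∈𝒮 T∈𝒞)

∈-products⁺ʳ : ∀ {𝒮 𝒞 : List (Part (suc h) (Fin n))} {S T} → S ∈ 𝒮 → T ∈ 𝒞 → T ⊗ S ∈ products 𝒮 𝒞
∈-products⁺ʳ {h} {n} {𝒮} {𝒞} S∈𝒮 T∈𝒞 =
  ∈-++⁺ʳ (cartesianProductWith _⊗_ 𝒮 𝒞) (∈-cartesianProductWith⁺ (_⊗_ {h} {n}) T∈𝒞 S∈𝒮)

products-separate : ∀ {𝒮 𝒞 : List (Part (suc h) (Fin n))} → Separates 𝒮 → Covers 𝒞 →
  ∀ {e e'} → e ≢ e' → ∃[ H ] (H ∈ products 𝒮 𝒞 × e ∈E H × ¬ (e' ∈E H))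
products-separate sep cov {a , b} {a' , b'} e≢e' with a ≟ a'
... | no a≢a' with sep a≢a' | cov b
...   | S , S∈𝒮 , a∈S , a'∉S | T , T∈𝒞 , b∈T =
  S ⊗ T , ∈-products⁺ˡ S∈𝒮 T∈𝒞 , ∈E-⊗⁺ a∈S b∈T , a'∉S ∘ proj₁ ∘ ∈E-⊗⁻ S T
products-separate sep cov {a , b} {a' , b'} e≢e' | yes refl with sep (e≢e' ∘ cong (a ,_)) | cov a
... | S , S∈𝒮 , b∈S , b'∉S | T , T∈𝒞 , a∈T =
  T ⊗ S , ∈-products⁺ʳ S∈𝒮 T∈𝒞 , ∈E-⊗⁺ a∈T b∈S , b'∉S ∘ proj₂ ∘ ∈E-⊗⁻ T S

separatingSystem : PartSystem (suc h) (Fin n) s c → ∃[ F ] (Separating F × length F ≡ s * c + c * s)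
separatingSystem P =
  products separators covering ,
  (λ e e' e≢e' → products-separate separates covers e≢e' ,
                 products-separate separates covers (e≢e' ∘ sym)) ,
  trans (length-products separators covering)
        (cong₂ _+_ (cong₂ _*_ length-separators length-covering)
                   (cong₂ _*_ length-covering length-separators))
  where open PartSystem P

module _ (ι : A ↣ B) where
  open Injection ι

  mapParts : List (Part h A) → List (Part h B)
  mapParts = map (ι ↣-∘_)

  ∈ᵖ-map⁺ : ∀ {S : Part h A} {x} → x ∈ᵖ S → to x ∈ᵖ (ι ↣-∘ S)
  ∈ᵖ-map⁺ (member i refl) = member i refl

  ∈ᵖ-map⁻ : ∀ {S : Part h A} {x} → to x ∈ᵖ (ι ↣-∘ S) → x ∈ᵖ S
  ∈ᵖ-map⁻ (member i eq) = member i (injective eq)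

  covered-map : ∀ {𝒞 : List (Part h A)} {x} → Covered 𝒞 x → Covered (mapParts 𝒞) (to x)
  covered-map (S , S∈𝒞 , x∈S) = ι ↣-∘ S , ∈-map⁺ (ι ↣-∘_) S∈𝒞 , ∈ᵖ-map⁺ x∈S

  separated-map : ∀ {𝒮 : List (Part h A)} {x x'} →
    Separated 𝒮 x x' → Separated (mapParts 𝒮) (to x) (to x')
  separated-map (S , S∈𝒮 , x∈S , x'∉S) =
    ι ↣-∘ S , ∈-map⁺ (ι ↣-∘_) S∈𝒮 , ∈ᵖ-map⁺ x∈S , x'∉S ∘ ∈ᵖ-map⁻

  separated-map-outside : ∀ {𝒮 : List (Part h A)} {x y} →
    Covered 𝒮 x → (∀ a → to a ≢ y) → Separated (mapParts 𝒮) (to x) y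
  separated-map-outside (S , S∈𝒮 , x∈S) y∉ι =
    ι ↣-∘ S , ∈-map⁺ (ι ↣-∘_) S∈𝒮 , ∈ᵖ-map⁺ x∈S , λ (member i eq) → y∉ι _ eq

partSystem-↔ : A ↔ B → PartSystem h A s c → PartSystem h B s c
partSystem-↔ {B = B} π P = record
  { separators        = mapParts ι separators
  ; covering          = mapParts ι covering
  ; separates         = λ {x} {x'} x≢x' →
      subst₂ (Separated _) (strictlyInverseˡ x) (strictlyInverseˡ x')
        (separated-map ι (separates (x≢x' ∘ Injection.injective (↔⇒↣ (↔-sym π)))))
  ; separators-cover  = onto (covered-map ι ∘ separators-cover)
  ; covers            = onto (covered-map ι ∘ covers)
  ; length-separators = trans (length-map _ separators) length-separators
  ; length-covering   = trans (length-map _ covering) length-covering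
  }
  where
  open PartSystem P
  open Inverse π
  ι = ↔⇒↣ π
  onto : ∀ {Q : B → Set} → (∀ a → Q (to a)) → ∀ x → Q x
  onto {Q} q x = subst Q (strictlyInverseˡ x) (q (from x))

data PunchInView {N} (p : Fin (suc N)) : Fin (suc N) → Set where
  hole    : PunchInView p p
  punched : ∀ y → PunchInView p (punchIn p y)

punchInView : ∀ {N} (p x : Fin (suc N)) → PunchInView p x
punchInView p x with x ≟ p
... | yes refl = hole
... | no x≢p   = subst (PunchInView p) (punchIn-punchOut (x≢p ∘ sym)) (punched _)

punchIn↣ : ∀ {N} → Fin (suc N) → Fin N ↣ Fin (suc N)
punchIn↣ p = mk↣ (punchIn-injective p _ _)

module _ {N} (p q : Fin (suc N)) (p≢q : p ≢ q) where

  windows : List (Part h (Fin N)) → List (Part h (Fin (suc N)))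
  windows 𝒮 = mapParts (punchIn↣ p) 𝒮 ++ mapParts (punchIn↣ q) 𝒮

  windows-cover : ∀ {𝒞 : List (Part h (Fin N))} → Covers 𝒞 → Covers (windows 𝒞)
  windows-cover cov x with punchInView p x | punchInView q x
  ... | punched y | _         = covered-⊆ ∈-++⁺ˡ (covered-map (punchIn↣ p) (cov y))
  ... | hole      | punched y = covered-⊆ (∈-++⁺ʳ _) (covered-map (punchIn↣ q) (cov y))
  ... | hole      | hole      = contradiction refl p≢q

  separated-window : ∀ {𝒮 : List (Part h (Fin N))} → Separates 𝒮 → Covers 𝒮 →
    ∀ r y {x'} → punchIn r y ≢ x' → Separated (mapParts (punchIn↣ r) 𝒮) (punchIn r y) x'
  separated-window sep cov r y {x'} x≢x' with punchInView r x'
  ... | hole       = separated-map-outside (punchIn↣ r) (cov y) (punchInᵢ≢i r)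
  ... | punched _  = separated-map (punchIn↣ r) (sep (x≢x' ∘ cong (punchIn r)))

  windows-separate : ∀ {𝒮 : List (Part h (Fin N))} → Separates 𝒮 → Covers 𝒮 → Separates (windows 𝒮)
  windows-separate sep cov {x} x≢x' with punchInView p x | punchInView q x
  ... | punched y | _         = separated-⊆ ∈-++⁺ˡ (separated-window sep cov p y x≢x')
  ... | hole      | punched y = separated-⊆ (∈-++⁺ʳ _) (separated-window sep cov q y x≢x')
  ... | hole      | hole      = contradiction refl p≢q

  length-windows : ∀ (𝒮 : List (Part h (Fin N))) → length (windows 𝒮) ≡ length 𝒮 + length 𝒮
  length-windows 𝒮 = trans (length-++ (mapParts (punchIn↣ p) 𝒮))
    (cong₂ _+_ (length-map _ 𝒮) (length-map _ 𝒮))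

  partSystem-suc : PartSystem h (Fin N) s c → PartSystem h (Fin (suc N)) (s + s) (c + c)
  partSystem-suc P = record
    { separators        = windows separators
    ; covering          = windows covering
    ; separates         = windows-separate separates separators-cover
    ; separators-cover  = windows-cover separators-cover
    ; covers            = windows-cover covers
    ; length-separators = trans (length-windows separators)
                                (cong₂ _+_ length-separators length-separators)
    ; length-covering   = trans (length-windows covering) (cong₂ _+_ length-covering length-covering)
    }
    where open PartSystem P

Distinguishes : List (A → Bool) → Set
Distinguishes {A} Γ = ∀ {y y' : A} → y ≢ y' → ∃[ χ ] (χ ∈ Γ × χ y ≢ χ y')

distinguishes-∘ : ∀ {f : A → B} {Γ} → Injective _≡_ _≡_ f →
  Distinguishes Γ → Distinguishes (map (_∘ f) Γ)
distinguishes-∘ {f = f} f-inj dist y≢y' with dist (y≢y' ∘ f-inj)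
... | χ , χ∈Γ , χy≢χy' = χ ∘ f , ∈-map⁺ (_∘ f) χ∈Γ , χy≢χy'

distinguishes-× : ∀ {Γ : List (A → Bool)} →
  Distinguishes Γ → Distinguishes (proj₁ ∷ map (_∘ proj₂) Γ)
distinguishes-× dist {b , y} {b' , y'} ne with b Bool.≟ b'
... | no b≢b' = proj₁ , here refl , b≢b'
... | yes refl with dist (ne ∘ cong (b ,_))
...   | χ , χ∈Γ , χy≢χy' = χ ∘ proj₂ , there (∈-map⁺ (_∘ proj₂) χ∈Γ) , χy≢χy'

2*↔Bool× : Fin (2 * m) ↔ (Bool × Fin m)
2*↔Bool× {m} = (2↔Bool ×-↔ ↔-id (Fin m)) ↔-∘ *↔×

binaryDigits : ∀ K → List (Fin (2 ^ K) → Bool)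
binaryDigits 0       = []
binaryDigits (suc K) = map (_∘ Inverse.to 2*↔Bool×) (proj₁ ∷ map (_∘ proj₂) (binaryDigits K))

binaryDigits-distinguish : ∀ K → Distinguishes (binaryDigits K)
binaryDigits-distinguish 0       {zero} {zero} ne = contradiction refl ne
binaryDigits-distinguish (suc K) =
  distinguishes-∘ (Injection.injective (↔⇒↣ 2*↔Bool×))
                  (distinguishes-× (binaryDigits-distinguish K))

length-binaryDigits : ∀ K → length (binaryDigits K) ≡ K
length-binaryDigits 0       = refl
length-binaryDigits (suc K) =
  trans (length-map _ (proj₁ ∷ map _ (binaryDigits K)))
        (cong suc (trans (length-map _ (binaryDigits K)) (length-binaryDigits K)))

choose : (Fin m → Bool) → Part m (Bool × Fin m)
choose χ = mk↣ {to = λ i → χ i , i} (cong proj₂)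

∈ᵖ-choose⁺ : ∀ {χ : Fin m → Bool} {b y} → χ y ≡ b → (b , y) ∈ᵖ choose χ
∈ᵖ-choose⁺ {y = y} refl = member y refl

∈ᵖ-choose⁻ : ∀ {χ : Fin m → Bool} {b y} → (b , y) ∈ᵖ choose χ → χ y ≡ b
∈ᵖ-choose⁻ (member _ refl) = refl

halves : List (Part m (Bool × Fin m))
halves = choose (const false) ∷ choose (const true) ∷ []

const∈halves : ∀ b → choose {m} (const b) ∈ halves
const∈halves false = here refl
const∈halves true  = there (here refl)

halves-cover : Covers (halves {m})
halves-cover (b , y) = choose (const b) , const∈halves b , ∈ᵖ-choose⁺ refl

choices : List (Fin m → Bool) → List (Part m (Bool × Fin m))
choices Γ = halves ++ map choose (Γ ++ map (not ∘_) Γ)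

choose∈choices : ∀ {Γ : List (Fin m → Bool)} {χ} → χ ∈ Γ → choose χ ∈ choices Γ
choose∈choices χ∈Γ = ∈-++⁺ʳ halves (∈-map⁺ choose (∈-++⁺ˡ χ∈Γ))

choose-not∈choices : ∀ {Γ : List (Fin m → Bool)} {χ} → χ ∈ Γ → choose (not ∘ χ) ∈ choices Γ
choose-not∈choices {Γ = Γ} χ∈Γ = ∈-++⁺ʳ halves (∈-map⁺ choose (∈-++⁺ʳ Γ (∈-map⁺ (not ∘_) χ∈Γ)))

choose-separates : ∀ {χ : Fin m → Bool} {b y y'} →
  χ y ≡ b → χ y' ≢ b → (b , y) ∈ᵖ choose χ × (b , y') ∉ᵖ choose χ
choose-separates χy≡b χy'≢b = ∈ᵖ-choose⁺ χy≡b , χy'≢b ∘ ∈ᵖ-choose⁻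

choices-separate : ∀ {Γ : List (Fin m → Bool)} → Distinguishes Γ → Separates (choices Γ)
choices-separate dist {b , y} {b' , y'} ne with b Bool.≟ b'
... | no b≢b' = choose (const b) , ∈-++⁺ˡ (const∈halves b) , ∈ᵖ-choose⁺ refl , b≢b' ∘ ∈ᵖ-choose⁻
... | yes refl with dist (ne ∘ cong (b ,_))
...   | χ , χ∈Γ , χy≢χy' with χ y Bool.≟ b
...     | yes χy≡b =
  choose χ , choose∈choices χ∈Γ , choose-separates χy≡b (χy≢χy' ∘ trans χy≡b ∘ sym)
...     | no χy≢b  =
  choose (not ∘ χ) , choose-not∈choices χ∈Γ ,
  choose-separates not-χy≡b (χy≢χy' ∘ Bool.not-injective ∘ trans not-χy≡b ∘ sym)
  where not-χy≡b = sym (Bool.¬-not (χy≢b ∘ sym))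

partSystem-choices : ∀ {Γ : List (Fin m → Bool)} → Distinguishes Γ →
  PartSystem m (Bool × Fin m) (2 + (length Γ + length Γ)) 2
partSystem-choices {Γ = Γ} dist = record
  { separators        = choices Γ
  ; covering          = halves
  ; separates         = choices-separate dist
  ; separators-cover  = covered-⊆ ∈-++⁺ˡ ∘ halves-cover
  ; covers            = halves-cover
  ; length-separators = cong (2 +_) (trans (length-map choose (Γ ++ map (not ∘_) Γ))
                          (trans (length-++ Γ) (cong (length Γ +_) (length-map (not ∘_) Γ))))
  ; length-covering   = refl
  }

partSystem-2* : ∀ K → m ≤ 2 ^ K → PartSystem m (Fin (2 * m)) (2 + (K + K)) 2
partSystem-2* K m≤2^K = partSystem-↔ (↔-sym 2*↔Bool×)
  (subst (λ k → PartSystem _ _ (2 + (k + k)) 2) length-Γ (partSystem-choices distinguish))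
  where
  Γ = map (_∘ λ y → inject≤ y m≤2^K) (binaryDigits K)
  distinguish : Distinguishes Γ
  distinguish = distinguishes-∘ (inject≤-injective m≤2^K m≤2^K _ _) (binaryDigits-distinguish K)
  length-Γ : length Γ ≡ K
  length-Γ = trans (length-map _ (binaryDigits K)) (length-binaryDigits K)

n<2^suc⌊log₂n⌋ : ∀ n → n < 2 ^ suc ⌊log₂ n ⌋
n<2^suc⌊log₂n⌋ n = ≰⇒> λ 2^suc⌊log₂n⌋≤n →
  1+n≰n (subst (_≤ ⌊log₂ n ⌋) (⌊log₂[2^n]⌋≡n (suc ⌊log₂ n ⌋)) (⌊log₂⌋-mono-≤ 2^suc⌊log₂n⌋≤n))

2*m≤n⇒m≤2^L : ∀ {m n} L → 2 * m ≤ n → n < 2 ^ suc L → m ≤ 2 ^ L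
2*m≤n⇒m≤2^L {m} {n} L 2*m≤n n<2^suc[L] = <⇒≤ (*-cancelˡ-< 2 m (2 ^ L) (≤-<-trans 2*m≤n n<2^suc[L]))

2+2L+2+2L≡4[1+L] : ∀ L → (2 + (L + L)) + (2 + (L + L)) ≡ 4 * suc L
2+2L+2+2L≡4[1+L] = solve-∀

data Halving : ℕ → Set where
  even : ∀ m → Halving (2 * m)
  odd  : ∀ m → Halving (suc (2 * m))

halving : ∀ n → Halving n
halving 0             = even 0
halving 1             = odd 0
halving (suc (suc n)) with halving n
... | even m = subst Halving (*-suc 2 m) (even (suc m))
... | odd m  = subst Halving (cong suc (*-suc 2 m)) (odd (suc m))

partSystem : ∀ {n L} → Halving n → 2 ≤ n → n < 2 ^ suc L →
  ∃[ h ] ∃[ s ] ∃[ c ] (PartSystem (suc h) (Fin n) s c × s ≤ 4 * suc L × c ≤ 4)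
partSystem (even 0)       ()
partSystem (odd 0)        (s≤s ())
partSystem {L = L} (even (suc m)) _ n<2^suc[L] =
  m , _ , _ , partSystem-2* L (2*m≤n⇒m≤2^L L ≤-refl n<2^suc[L]) ,
  ≤-trans (m≤m+n _ _) (≤-reflexive (2+2L+2+2L≡4[1+L] L)) , s≤s (s≤s z≤n)
partSystem {L = L} (odd (suc m))  _ n<2^suc[L] =
  m , _ , _ ,
  partSystem-suc zero (suc zero) (λ ()) (partSystem-2* L (2*m≤n⇒m≤2^L L (n≤1+n _) n<2^suc[L])) ,
  ≤-reflexive (2+2L+2+2L≡4[1+L] L) , ≤-refl

size-bound : ∀ {s c} L → 1 ≤ L → s ≤ 4 * suc L → c ≤ 4 → s * c + c * s ≤ 64 * L
size-bound {s} {c} L 1≤L s≤ c≤ = begin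
  s * c + c * s                   ≤⟨ +-mono-≤ (*-mono-≤ s≤ c≤) (*-mono-≤ c≤ s≤) ⟩
  4 * suc L * 4 + 4 * (4 * suc L) ≡⟨ expand L ⟩
  32 + 32 * L                     ≤⟨ +-monoˡ-≤ (32 * L) (*-monoʳ-≤ 32 1≤L) ⟩
  32 * L + 32 * L                 ≡⟨ collect L ⟩
  64 * L                          ∎
  where
  open ≤-Reasoning
  expand : ∀ L → 4 * suc L * 4 + 4 * (4 * suc L) ≡ 32 + 32 * L
  expand = solve-∀
  collect : ∀ L → 32 * L + 32 * L ≡ 64 * L
  collect = solve-∀

mainTheorem4 : ∃[ C ] (∀ (n : ℕ) → 2 ≤ n →
    ∃[ F ] (Separating {n} F × length F ≤ C * ⌊log₂ n ⌋))
mainTheorem4 = 64 , λ n 2≤n →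
  let _ , _ , _ , P , s≤ , c≤ = partSystem (halving n) 2≤n (n<2^suc⌊log₂n⌋ n)
      F , separating , length-F = separatingSystem P
  in F , separating , ≤-trans (≤-reflexive length-F) (size-bound _ (⌊log₂⌋-mono-≤ 2≤n) s≤ c≤)
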